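{- Let $\mathbf A$ be a finite hoop and let $\mathbf M$ be a finite MV-chain with at least two elements. Let $P_{\mathbf A}^{\mathbf M}$ be the set of all product morphisms from $\mathbf A$ to $\mathbf M$, $P_{\mathbf M}^{\mathbf A}$ the set of all product morphisms from $\mathbf M$ to $\mathbf A$, and $\mathbf{Id}\,\mathbf A=\{x\in A\mid x\cdot x=x\}$. Then there exist bijections $\nu\colon P_{\mathbf A}^{\mathbf M}\to\mathbf{Id}\,\mathbf A$ and $\mu\colon P_{\mathbf M}^{\mathbf A}\to\mathbf{Id}\,\mathbf A$.
   Context: A hoop is an algebra $\mathbf A=(A;\cdot,\rightarrow,1)$ of type $\langle 2,2,0\rangle$ such that $(A;\cdot,1)$ is a commutative monoid and the identities $x\rightarrow x=1$, $(x\cdot y)\rightarrow z=x\rightarrow(y\rightarrow z)$ and $x\cdot(x\rightarrow y)=y\cdot(y\rightarrow x)$ hold. The order is $x\leq y$ iff $x\rightarrow y=1$; infima exist and $x\wedge y=x\cdot(x\rightarrow y)$. A finite MV-chain is regarded as a hoop via its reduct $(M;\cdot,\rightarrow,1)$. A map $f\colon B\to C$ between hoops is a product morphism if $f(1)=1$ and $f(x)\cdot f(y)=f(x\cdot y)=f(x)\wedge f(y)=f(x\wedge y)$ for all $x,y\in B$. -}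

module Defs where

open import Data.Nat using (ℕ)
open import Data.Fin using (Fin)
open import Data.Product using (Σ; _×_; _,_; proj₁; ∃; ∃₂)
open import Data.Sum using (_⊎_)
open import Relation.Binary.PropositionalEquality using (_≡_; _≢_)
open import Relation.Binary.Bundles using (Setoid)
open import Relation.Binary.Structures using (IsEquivalence)
open import Function.Bundles using (_↔_)
open import Level using (0ℓ)

record Hoop : Set₁ where
  infixl 7 _·_
  infixr 5 _⇒_
  field
    Carrier : Set
    _·_     : Carrier → Carrier → Carrier
    _⇒_     : Carrier → Carrier → Carrier
    one     : Carrier
    ·-assoc    : ∀ x y z → (x · y) · z ≡ x · (y · z)
    ·-comm     : ∀ x y → x · y ≡ y · x
    ·-identityʳ : ∀ x → x · one ≡ x
    ⇒-refl     : ∀ x → x ⇒ x ≡ one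
    ⇒-curry    : ∀ x y z → (x · y) ⇒ z ≡ x ⇒ (y ⇒ z)
    ·⇒-swap    : ∀ x y → x · (x ⇒ y) ≡ y · (y ⇒ x)

  _≤_ : Carrier → Carrier → Set
  x ≤ y = x ⇒ y ≡ one

  _∧_ : Carrier → Carrier → Carrier
  x ∧ y = x · (x ⇒ y)

Finite : Set → Set
Finite X = Σ ℕ λ n → X ↔ Fin n

-- MV-algebras are term-equivalent to bounded Wajsberg hoops
-- (x ⊕ y = ¬x → y, ¬x = x → 0); we record the hoop reduct together with
-- the bottom 0, the Wajsberg identity, linearity of the order,
-- finiteness and the existence of two distinct elements.
record FiniteMVChain : Set₁ where
  field
    hoop : Hoop
  open Hoop hoop
  field
    zero      : Carrier
    zero-least : ∀ x → zero ≤ x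
    wajsberg  : ∀ x y → (x ⇒ y) ⇒ y ≡ (y ⇒ x) ⇒ x
    chain     : ∀ x y → (x ≤ y) ⊎ (y ≤ x)
    finite    : Finite Carrier
    nontrivial : ∃₂ λ (a b : Carrier) → a ≢ b

record IsProductMorphism (B C : Hoop) (f : Hoop.Carrier B → Hoop.Carrier C) : Set where
  private
    module B = Hoop B
    module C = Hoop C
  field
    pres-one : f B.one ≡ C.one
    prod₁    : ∀ x y → f x C.· f y ≡ f (x B.· y)
    prod₂    : ∀ x y → f (x B.· y) ≡ f x C.∧ f y
    prod₃    : ∀ x y → f x C.∧ f y ≡ f (x B.∧ y)

ProductMorphism : Hoop → Hoop → Set
ProductMorphism B C = Σ (Hoop.Carrier B → Hoop.Carrier C) (IsProductMorphism B C)

P : Hoop → Hoop → Setoid 0ℓ 0ℓ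
P B C = record
  { Carrier = ProductMorphism B C
  ; _≈_ = λ f g → ∀ x → proj₁ f x ≡ proj₁ g x
  ; isEquivalence = record
    { refl = λ x → Relation.Binary.PropositionalEquality.refl
    ; sym = λ p x → Relation.Binary.PropositionalEquality.sym (p x)
    ; trans = λ p q x → Relation.Binary.PropositionalEquality.trans (p x) (q x)
    }
  }

Idem : Hoop → Setoid 0ℓ 0ℓ
Idem A = record
  { Carrier = Σ (Hoop.Carrier A) (λ x → Hoop._·_ A x x ≡ x)
  ; _≈_ = λ u v → proj₁ u ≡ proj₁ v
  ; isEquivalence = record
    { refl = Relation.Binary.PropositionalEquality.refl
    ; sym = Relation.Binary.PropositionalEquality.sym
    ; trans = Relation.Binary.PropositionalEquality.trans
    }
  }

{-# OPTIONS --safe #-}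
-- A product morphism f takes only idempotent values, and its kernel
-- {x | f x = 1} is a filter.  An MV-chain has exactly two idempotents, 0 and 1,
-- so a product morphism A → M is the indicator of its kernel; in the finite
-- hoop A that kernel is the principal filter of an idempotent, the product of
-- all its elements.  In a finite MV-chain every x ≠ 1 has an iterated square
-- x^(2^k) equal to 0, and f (x · x) = f x, so a product morphism M → A is 1 at
-- 1 and f 0 elsewhere.  Conversely, for idempotent e these two-valued maps are
-- product morphisms, since · and ∧ both act as the meet on {e, 1}.
module Submission where

open import Defs
open import Algebra.Bundles using (CommutativeSemigroup)
import Algebra.Properties.CommutativeSemigroup as CommutativeSemigroupProperties
open import Data.Fin using (Fin; toℕ)
open import Data.Fin.Properties using (pigeonhole; inj⇒≟)
open import Data.Nat as ℕ using (ℕ; suc; z≤n; _≤′_; ≤′-refl; ≤′-step)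
open import Data.Nat.Properties using (n<1+n; ≤⇒≤′)
open import Data.Product using (_×_; _,_; proj₁; proj₂; ∃)
open import Data.Sum as Sum using (_⊎_; inj₁; inj₂; [_,_]′)
open import Data.Vec.Functional using (Vector; foldr; head; tail)
open import Function using (_∘_; id)
open import Function.Bundles using (Bijection; Inverse; Injection)
open import Function.Properties.Inverse using (↔⇒↣; Inverse⇒Bijection)
open import Level using (0ℓ)
open import Relation.Binary.Bundles using (Setoid)
open import Relation.Binary.Definitions using (DecidableEquality)
open import Relation.Binary.PropositionalEquality
open import Relation.Binary.PropositionalEquality.Algebra using (isMagma)
open import Relation.Nullary using (Dec; yes; no; ¬_; contradiction)
open import Relation.Unary using (Pred)

finite⇒≟ : {X : Set} → Finite X → DecidableEquality X
finite⇒≟ (_ , X↔Fin) = inj⇒≟ (↔⇒↣ X↔Fin)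

module HoopProperties (H : Hoop) where
  open Hoop H
  open ≡-Reasoning

  ·-commutativeSemigroup : CommutativeSemigroup 0ℓ 0ℓ
  ·-commutativeSemigroup = record
    { isCommutativeSemigroup = record
      { isSemigroup = record { isMagma = isMagma _·_ ; assoc = ·-assoc }
      ; comm        = ·-comm
      }
    }

  open CommutativeSemigroupProperties ·-commutativeSemigroup using (interchange)

  ·-identityˡ : ∀ x → one · x ≡ x
  ·-identityˡ x = trans (·-comm one x) (·-identityʳ x)

  ⇒-identityˡ : ∀ x → one ⇒ x ≡ x
  ⇒-identityˡ x = sym (begin
      x                   ≡⟨ sym (·-identityʳ x) ⟩
      x · one             ≡⟨ cong (x ·_) (sym x≤v) ⟩
      x · (x ⇒ v)         ≡⟨ ·⇒-swap x v ⟩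
      v · (v ⇒ x)         ≡⟨ cong₂ _·_ v≡x·u v⇒x≡u⇒one ⟩
      (x · u) · (u ⇒ one) ≡⟨ ·-assoc x u (u ⇒ one) ⟩
      x · (u · (u ⇒ one)) ≡⟨ cong (x ·_) u∧one≡u ⟩
      x · u               ≡⟨ sym v≡x·u ⟩
      v                   ∎)
    where
    u = x ⇒ one
    v = one ⇒ x

    x≤v : x ⇒ v ≡ one
    x≤v = begin
      x ⇒ (one ⇒ x) ≡⟨ sym (⇒-curry x one x) ⟩
      (x · one) ⇒ x ≡⟨ cong (_⇒ x) (·-identityʳ x) ⟩
      x ⇒ x         ≡⟨ ⇒-refl x ⟩
      one           ∎

    v≡x·u : v ≡ x · u
    v≡x·u = trans (sym (·-identityˡ v)) (·⇒-swap one x)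

    v⇒x≡u⇒one : v ⇒ x ≡ u ⇒ one
    v⇒x≡u⇒one = begin
      v ⇒ x       ≡⟨ cong (_⇒ x) (trans v≡x·u (·-comm x u)) ⟩
      (u · x) ⇒ x ≡⟨ ⇒-curry u x x ⟩
      u ⇒ (x ⇒ x) ≡⟨ cong (u ⇒_) (⇒-refl x) ⟩
      u ⇒ one     ∎

    u∧one≡u : u · (u ⇒ one) ≡ u
    u∧one≡u = begin
      u · (u ⇒ one)   ≡⟨ ·⇒-swap u one ⟩
      one · (one ⇒ u) ≡⟨ ·-identityˡ _ ⟩
      one ⇒ (x ⇒ one) ≡⟨ sym (⇒-curry one x one) ⟩
      (one · x) ⇒ one ≡⟨ cong (_⇒ one) (·-identityˡ x) ⟩
      u               ∎

  ∧-identityˡ : ∀ x → one ∧ x ≡ x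
  ∧-identityˡ x = trans (·-identityˡ (one ⇒ x)) (⇒-identityˡ x)

  ∧-identityʳ : ∀ x → x ∧ one ≡ x
  ∧-identityʳ x = trans (·⇒-swap x one) (∧-identityˡ x)

  ∧-idem : ∀ x → x ∧ x ≡ x
  ∧-idem x = trans (cong (x ·_) (⇒-refl x)) (·-identityʳ x)

  ⇒-zeroʳ : ∀ x → x ⇒ one ≡ one
  ⇒-zeroʳ x = begin
    x ⇒ one               ≡⟨ cong (_⇒ one) (sym (∧-identityʳ x)) ⟩
    (x · (x ⇒ one)) ⇒ one ≡⟨ cong (_⇒ one) (·-comm x (x ⇒ one)) ⟩
    ((x ⇒ one) · x) ⇒ one ≡⟨ ⇒-curry (x ⇒ one) x one ⟩
    (x ⇒ one) ⇒ (x ⇒ one) ≡⟨ ⇒-refl (x ⇒ one) ⟩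
    one                   ∎

  ≤-refl : ∀ x → x ≤ x
  ≤-refl = ⇒-refl

  x·y≤x : ∀ x y → (x · y) ≤ x
  x·y≤x x y = begin
    (x · y) ⇒ x ≡⟨ cong (_⇒ x) (·-comm x y) ⟩
    (y · x) ⇒ x ≡⟨ ⇒-curry y x x ⟩
    y ⇒ (x ⇒ x) ≡⟨ cong (y ⇒_) (⇒-refl x) ⟩
    y ⇒ one     ≡⟨ ⇒-zeroʳ y ⟩
    one         ∎

  x·y≤y : ∀ x y → (x · y) ≤ y
  x·y≤y x y = subst (_≤ y) (·-comm y x) (x·y≤x y x)

  x≡y·c⇒x≤y : ∀ {x y} c → x ≡ y · c → x ≤ y
  x≡y·c⇒x≤y {y = y} c x≡y·c = subst (_≤ y) (sym x≡y·c) (x·y≤x y c)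

  x≤y⇒x≡y·[y⇒x] : ∀ {x y} → x ≤ y → x ≡ y · (y ⇒ x)
  x≤y⇒x≡y·[y⇒x] {x} {y} x≤y = begin
    x           ≡⟨ sym (·-identityʳ x) ⟩
    x · one     ≡⟨ cong (x ·_) (sym x≤y) ⟩
    x · (x ⇒ y) ≡⟨ ·⇒-swap x y ⟩
    y · (y ⇒ x) ∎

  ≤-antisym : ∀ {x y} → x ≤ y → y ≤ x → x ≡ y
  ≤-antisym {x} {y} x≤y y≤x = begin
    x           ≡⟨ x≤y⇒x≡y·[y⇒x] x≤y ⟩
    y · (y ⇒ x) ≡⟨ cong (y ·_) y≤x ⟩
    y · one     ≡⟨ ·-identityʳ y ⟩
    y           ∎

  ≤-trans : ∀ {x y z} → x ≤ y → y ≤ z → x ≤ z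
  ≤-trans {x} {y} {z} x≤y y≤z = x≡y·c⇒x≤y ((z ⇒ y) · (y ⇒ x)) (begin
    x                         ≡⟨ x≤y⇒x≡y·[y⇒x] x≤y ⟩
    y · (y ⇒ x)               ≡⟨ cong (_· (y ⇒ x)) (x≤y⇒x≡y·[y⇒x] y≤z) ⟩
    (z · (z ⇒ y)) · (y ⇒ x)   ≡⟨ ·-assoc z (z ⇒ y) (y ⇒ x) ⟩
    z · ((z ⇒ y) · (y ⇒ x))   ∎)

  ·-mono-≤ : ∀ {a b x y} → a ≤ x → b ≤ y → (a · b) ≤ (x · y)
  ·-mono-≤ {a} {b} {x} {y} a≤x b≤y = x≡y·c⇒x≤y ((x ⇒ a) · (y ⇒ b)) (begin
    a · b                       ≡⟨ cong₂ _·_ (x≤y⇒x≡y·[y⇒x] a≤x) (x≤y⇒x≡y·[y⇒x] b≤y) ⟩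
    (x · (x ⇒ a)) · (y · (y ⇒ b)) ≡⟨ interchange x (x ⇒ a) y (y ⇒ b) ⟩
    (x · y) · ((x ⇒ a) · (y ⇒ b)) ∎)

  x∧y≤x : ∀ x y → (x ∧ y) ≤ x
  x∧y≤x x y = x·y≤x x (x ⇒ y)

  x∧y≤y : ∀ x y → (x ∧ y) ≤ y
  x∧y≤y x y = x≡y·c⇒x≤y (y ⇒ x) (·⇒-swap x y)

  x·y≤x∧y : ∀ x y → (x · y) ≤ (x ∧ y)
  x·y≤x∧y x y = ·-mono-≤ (≤-refl x) (trans (sym (⇒-curry y x y)) (x·y≤x y x))

  x≤y⇒x∧y≡x : ∀ {x y} → x ≤ y → x ∧ y ≡ x
  x≤y⇒x∧y≡x {x} x≤y = trans (cong (x ·_) x≤y) (·-identityʳ x)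

  one≤x⇒x≡one : ∀ {x} → one ≤ x → x ≡ one
  one≤x⇒x≡one {x} one≤x = trans (sym (⇒-identityˡ x)) one≤x

  ≤-decidable : DecidableEquality Carrier → ∀ x y → Dec (x ≤ y)
  ≤-decidable _≟_ x y = (x ⇒ y) ≟ one

  ∏ : ∀ {n} → Vector Carrier n → Carrier
  ∏ = foldr _·_ one

  ∏≤ : ∀ {n} (h : Vector Carrier n) i → ∏ h ≤ h i
  ∏≤ h Fin.zero    = x·y≤x (head h) (∏ (tail h))
  ∏≤ h (Fin.suc i) = ≤-trans (x·y≤y (head h) (∏ (tail h))) (∏≤ (tail h) i)

  infixl 8 _^2^_

  _^2^_ : Carrier → ℕ → Carrier
  x ^2^ ℕ.zero  = x
  x ^2^ suc k = (x ^2^ k) · (x ^2^ k)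

  ^2^-antitone : ∀ x {m n} → m ≤′ n → (x ^2^ n) ≤ (x ^2^ m)
  ^2^-antitone x ≤′-refl         = ≤-refl _
  ^2^-antitone x (≤′-step m≤′n) = ≤-trans (x·y≤x _ _) (^2^-antitone x m≤′n)

  ^2^-eventually-idempotent : Finite Carrier → ∀ x → ∃ λ k → (x ^2^ k) · (x ^2^ k) ≡ x ^2^ k
  ^2^-eventually-idempotent (n , X↔Fin) x
    with pigeonhole (n<1+n n) (λ i → Inverse.to X↔Fin (x ^2^ toℕ i))
  ... | i , j , i<j , same-code = toℕ i , ≤-antisym (x·y≤x y y) y≤y·y
    where
    y = x ^2^ toℕ i

    y≤y·y : y ≤ (y · y)
    y≤y·y = subst (_≤ (y · y)) (sym (Injection.injective (↔⇒↣ X↔Fin) same-code))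
                  (^2^-antitone x (≤⇒≤′ i<j))

  record IsFilter (F : Pred Carrier 0ℓ) : Set where
    field
      one∈     : F one
      ∈-upward : ∀ {x y} → x ≤ y → F x → F y
      ·-closed : ∀ {x y} → F x → F y → F (x · y)

    ·-split : ∀ {x y} → F (x · y) → F x × F y
    ·-split {x} {y} Fx·y = ∈-upward (x·y≤x x y) Fx·y , ∈-upward (x·y≤y x y) Fx·y

    ∧-closed : ∀ {x y} → F x → F y → F (x ∧ y)
    ∧-closed {x} {y} Fx Fy = ∈-upward (x·y≤x∧y x y) (·-closed Fx Fy)

    ∧-split : ∀ {x y} → F (x ∧ y) → F x × F y
    ∧-split {x} {y} Fx∧y = ∈-upward (x∧y≤x x y) Fx∧y , ∈-upward (x∧y≤y x y) Fx∧y

    ∏-closed : ∀ {n} (h : Vector Carrier n) → (∀ i → F (h i)) → F (∏ h)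
    ∏-closed {ℕ.zero} h Fh = one∈
    ∏-closed {suc n}  h Fh = ·-closed (Fh Fin.zero) (∏-closed (tail h) (Fh ∘ Fin.suc))

  ↑-isFilter : ∀ {e} → e · e ≡ e → IsFilter (e ≤_)
  ↑-isFilter {e} e·e≡e = record
    { one∈     = ⇒-zeroʳ e
    ; ∈-upward = λ x≤y e≤x → ≤-trans e≤x x≤y
    ; ·-closed = λ e≤x e≤y → subst (_≤ _) e·e≡e (·-mono-≤ e≤x e≤y)
    }

  ≡one-isFilter : IsFilter (_≡ one)
  ≡one-isFilter = record
    { one∈     = refl
    ; ∈-upward = λ x≤y x≡one → one≤x⇒x≡one (subst (_≤ _) x≡one x≤y)
    ; ·-closed = λ { refl refl → ·-identityʳ one }
    }

  module Generator (finite : Finite Carrier) {F : Pred Carrier 0ℓ}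
                   (isFilter : IsFilter F) (F? : ∀ x → Dec (F x)) where
    open IsFilter isFilter

    private
      open Inverse (proj₂ finite) using (to; from; strictlyInverseʳ)

      keepIfIn : Carrier → Carrier
      keepIfIn x with F? x
      ... | yes _ = x
      ... | no _  = one

      keepIfIn∈ : ∀ x → F (keepIfIn x)
      keepIfIn∈ x with F? x
      ... | yes Fx = Fx
      ... | no _   = one∈

      keepIfIn-∈ : ∀ {x} → F x → keepIfIn x ≡ x
      keepIfIn-∈ {x} Fx with F? x
      ... | yes _  = refl
      ... | no ¬Fx = contradiction Fx ¬Fx

    generator : Carrier
    generator = ∏ (keepIfIn ∘ from)

    generator∈ : F generator
    generator∈ = ∏-closed _ (keepIfIn∈ ∘ from)

    generator-least : ∀ {x} → F x → generator ≤ x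
    generator-least {x} Fx = subst (generator ≤_) keepIfIn-from-to (∏≤ _ (to x))
      where
      keepIfIn-from-to : keepIfIn (from (to x)) ≡ x
      keepIfIn-from-to = trans (cong keepIfIn (strictlyInverseʳ x)) (keepIfIn-∈ Fx)

    generator-idempotent : generator · generator ≡ generator
    generator-idempotent = ≤-antisym (x·y≤x _ _) (generator-least (·-closed generator∈ generator∈))

module ProductMorphismProperties {B C : Hoop} {f : Hoop.Carrier B → Hoop.Carrier C}
                                 (isPM : IsProductMorphism B C f) where
  private
    module B = Hoop B
    module C = Hoop C
    module HB = HoopProperties B
    module HC = HoopProperties C
  open IsProductMorphism isPM
  open ≡-Reasoning

  f-idempotent : ∀ x → f x C.· f x ≡ f x
  f-idempotent x = begin
    f x C.· f x ≡⟨ prod₁ x x ⟩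
    f (x B.· x) ≡⟨ prod₂ x x ⟩
    f x C.∧ f x ≡⟨ prod₃ x x ⟩
    f (x B.∧ x) ≡⟨ cong f (HB.∧-idem x) ⟩
    f x         ∎

  f-^2^ : ∀ k x → f (x HB.^2^ k) ≡ f x
  f-^2^ ℕ.zero  x = refl
  f-^2^ (suc k) x = trans (sym (prod₁ _ _)) (trans (f-idempotent _) (f-^2^ k x))

  f-mono : ∀ {x y} → x B.≤ y → f x C.≤ f y
  f-mono {x} {y} x≤y = subst (C._≤ f y) (trans (prod₃ x y) (cong f (HB.x≤y⇒x∧y≡x x≤y)))
                             (HC.x∧y≤y (f x) (f y))

  kernel-isFilter : HB.IsFilter (λ x → f x ≡ C.one)
  kernel-isFilter = record
    { one∈     = pres-one
    ; ∈-upward = λ x≤y fx≡one → HC.one≤x⇒x≡one (subst (C._≤ _) fx≡one (f-mono x≤y))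
    ; ·-closed = λ {x} {y} fx≡one fy≡one → begin
        f (x B.· y)     ≡⟨ sym (prod₁ x y) ⟩
        f x C.· f y     ≡⟨ cong₂ C._·_ fx≡one fy≡one ⟩
        C.one C.· C.one ≡⟨ C.·-identityʳ C.one ⟩
        C.one           ∎
    }

module Indicator {B C : Hoop} {F : Pred (Hoop.Carrier B) 0ℓ}
                 (F? : ∀ x → Dec (F x)) (e : Hoop.Carrier C) where
  private
    module B = Hoop B
    module C = Hoop C
    module HB = HoopProperties B
    module HC = HoopProperties C

  indicator : B.Carrier → C.Carrier
  indicator x with F? x
  ... | yes _ = C.one
  ... | no _  = e

  indicator-∈ : ∀ {x} → F x → indicator x ≡ C.one
  indicator-∈ {x} Fx with F? x
  ... | yes _  = refl
  ... | no ¬Fx = contradiction Fx ¬Fx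

  indicator-∉ : ∀ {x} → ¬ F x → indicator x ≡ e
  indicator-∉ {x} ¬Fx with F? x
  ... | yes Fx = contradiction Fx ¬Fx
  ... | no _   = refl

  indicator≡ : ∀ {x y} → (F x → y ≡ C.one) → (¬ F x → y ≡ e) → indicator x ≡ y
  indicator≡ {x} ∈⇒y≡one ∉⇒y≡e with F? x
  ... | yes Fx  = sym (∈⇒y≡one Fx)
  ... | no ¬Fx = sym (∉⇒y≡e ¬Fx)

  indicator≡one⇒∈ : e ≢ C.one → ∀ {x} → indicator x ≡ C.one → F x
  indicator≡one⇒∈ e≢one {x} indicator≡one with F? x
  ... | yes Fx = Fx
  ... | no _   = contradiction indicator≡one e≢one

  private
    indicator-homomorphic : (_⊙_ : B.Carrier → B.Carrier → B.Carrier)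
      → (_⊛_ : C.Carrier → C.Carrier → C.Carrier)
      → (∀ {x y} → F x → F y → F (x ⊙ y)) → (∀ {x y} → F (x ⊙ y) → F x × F y)
      → C.one ⊛ C.one ≡ C.one → C.one ⊛ e ≡ e → e ⊛ C.one ≡ e → e ⊛ e ≡ e
      → ∀ x y → indicator x ⊛ indicator y ≡ indicator (x ⊙ y)
    indicator-homomorphic _⊙_ _⊛_ closed split one⊛one one⊛e e⊛one e⊛e x y with F? x | F? y
    ... | yes Fx | yes Fy = trans one⊛one (sym (indicator-∈ (closed Fx Fy)))
    ... | yes _  | no ¬Fy = trans one⊛e (sym (indicator-∉ (¬Fy ∘ proj₂ ∘ split)))
    ... | no ¬Fx | yes _  = trans e⊛one (sym (indicator-∉ (¬Fx ∘ proj₁ ∘ split)))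
    ... | no ¬Fx | no _   = trans e⊛e (sym (indicator-∉ (¬Fx ∘ proj₁ ∘ split)))

  indicator-isProductMorphism : HB.IsFilter F → e C.· e ≡ e → IsProductMorphism B C indicator
  indicator-isProductMorphism isFilter e·e≡e = record
    { pres-one = indicator-∈ one∈
    ; prod₁    = indicator-homomorphic B._·_ C._·_ ·-closed ·-split
                   (C.·-identityʳ C.one) (HC.·-identityˡ e) (C.·-identityʳ e) e·e≡e
    ; prod₂    = λ x y → sym (indicator-homomorphic B._·_ C._∧_ ·-closed ·-split
                   (HC.∧-idem C.one) (HC.∧-identityˡ e) (HC.∧-identityʳ e) (HC.∧-idem e) x y)
    ; prod₃    = indicator-homomorphic B._∧_ C._∧_ ∧-closed ∧-split
                   (HC.∧-idem C.one) (HC.∧-identityˡ e) (HC.∧-identityʳ e) (HC.∧-idem e)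
    }
    where open HB.IsFilter isFilter

module FiniteMVChainProperties (M : FiniteMVChain) where
  open FiniteMVChain M
  open Hoop hoop
  open HoopProperties hoop
  open ≡-Reasoning

  _≟_ : DecidableEquality Carrier
  _≟_ = finite⇒≟ finite

  zero·zero≡zero : zero · zero ≡ zero
  zero·zero≡zero = ≤-antisym (x·y≤x zero zero) (zero-least _)

  zero≢one : zero ≢ one
  zero≢one zero≡one with nontrivial
  ... | a , b , a≢b = a≢b (trans (≡one a) (sym (≡one b)))
    where
    ≡one : ∀ x → x ≡ one
    ≡one x = one≤x⇒x≡one (subst (_≤ x) zero≡one (zero-least x))

  idempotent⇒zero⊎one : ∀ {x} → x · x ≡ x → x ≡ zero ⊎ x ≡ one
  idempotent⇒zero⊎one {x} x·x≡x = Sum.map x≤¬x⇒x≡zero ¬x≤x⇒x≡one (chain x ¬x)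
    where
    ¬x = x ⇒ zero

    x⇒¬x≡¬x : x ⇒ ¬x ≡ ¬x
    x⇒¬x≡¬x = trans (sym (⇒-curry x x zero)) (cong (_⇒ zero) x·x≡x)

    x≤¬x⇒x≡zero : x ≤ ¬x → x ≡ zero
    x≤¬x⇒x≡zero x≤¬x = ≤-antisym (trans (sym x⇒¬x≡¬x) x≤¬x) (zero-least x)

    ¬¬x≡x : ¬x ⇒ zero ≡ x
    ¬¬x≡x = trans (wajsberg x zero) (trans (cong (_⇒ x) (zero-least x)) (⇒-identityˡ x))

    ¬x≤x⇒x≡one : ¬x ≤ x → x ≡ one
    ¬x≤x⇒x≡one ¬x≤x = begin
      x           ≡⟨ sym ¬¬x≡x ⟩
      ¬x ⇒ zero   ≡⟨ cong (_⇒ zero) ¬x≡zero ⟩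
      zero ⇒ zero ≡⟨ ⇒-refl zero ⟩
      one         ∎
      where
      ¬x≡zero : ¬x ≡ zero
      ¬x≡zero = begin
        ¬x                ≡⟨ sym (x≤y⇒x∧y≡x ¬x≤x) ⟩
        ¬x ∧ x            ≡⟨ sym (·⇒-swap x ¬x) ⟩
        x · (x ⇒ ¬x)      ≡⟨ cong (x ·_) x⇒¬x≡¬x ⟩
        x ∧ zero          ≡⟨ ·⇒-swap x zero ⟩
        zero · (zero ⇒ x) ≡⟨ cong (zero ·_) (zero-least x) ⟩
        zero · one        ≡⟨ ·-identityʳ zero ⟩
        zero              ∎

  one⊎nilpotent : ∀ x → x ≡ one ⊎ ∃ λ k → x ^2^ k ≡ zero
  one⊎nilpotent x with ^2^-eventually-idempotent finite x
  ... | k , idempotent with idempotent⇒zero⊎one idempotent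
  ... | inj₁ x^2^k≡zero = inj₂ (k , x^2^k≡zero)
  ... | inj₂ x^2^k≡one  = inj₁ (one≤x⇒x≡one (subst (_≤ x) x^2^k≡one x^2^k≤x))
    where
    x^2^k≤x : (x ^2^ k) ≤ x
    x^2^k≤x = ^2^-antitone x {n = k} (≤⇒≤′ z≤n)

module ProductMorphismsToChain (A : Hoop) (finite : Finite (Hoop.Carrier A))
                               (M : FiniteMVChain) where
  open FiniteMVChain M using (hoop; zero)
  open FiniteMVChainProperties M using (_≟_; zero·zero≡zero; zero≢one; idempotent⇒zero⊎one)
  open ProductMorphismProperties using (f-idempotent; kernel-isFilter)
  private
    module A = Hoop A
    module HA = HoopProperties A
    module Mʰ = Hoop hoop
    module PA = Setoid (P A hoop)
    module Id = Setoid (Idem A)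

    module Kernel {f : A.Carrier → Mʰ.Carrier} (isPM : IsProductMorphism A hoop f) =
      HA.Generator finite (kernel-isFilter isPM) (λ x → f x ≟ Mʰ.one)

    _≤?_ : ∀ x y → Dec (x A.≤ y)
    _≤?_ = HA.≤-decidable (finite⇒≟ finite)

    module PrincipalIndicator (e : A.Carrier) = Indicator {A} {hoop} (e ≤?_) zero

  ν : PA.Carrier → Id.Carrier
  ν (_ , isPM) = generator , generator-idempotent
    where open Kernel isPM

  ν⁻¹ : Id.Carrier → PA.Carrier
  ν⁻¹ (e , e·e≡e) = indicator , indicator-isProductMorphism (HA.↑-isFilter e·e≡e) zero·zero≡zero
    where open PrincipalIndicator e

  ν-cong : ∀ {f g} → f PA.≈ g → ν f Id.≈ ν g
  ν-cong {_ , isPMf} {_ , isPMg} f≈g = HA.≤-antisym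
    (F.generator-least (trans (f≈g _) G.generator∈))
    (G.generator-least (trans (sym (f≈g _)) F.generator∈))
    where
    module F = Kernel isPMf
    module G = Kernel isPMg

  ν⁻¹-cong : ∀ {d e} → d Id.≈ e → ν⁻¹ d PA.≈ ν⁻¹ e
  ν⁻¹-cong {_ , _} {_ , _} refl _ = refl

  ν∘ν⁻¹ : ∀ e → ν (ν⁻¹ e) Id.≈ e
  ν∘ν⁻¹ (e , e·e≡e) = HA.≤-antisym (generator-least (indicator-∈ (HA.≤-refl e)))
                                   (indicator≡one⇒∈ zero≢one generator∈)
    where
    open PrincipalIndicator e
    open Kernel (proj₂ (ν⁻¹ (e , e·e≡e)))

  ν⁻¹∘ν : ∀ f → ν⁻¹ (ν f) PA.≈ f
  ν⁻¹∘ν (f , isPM) x = indicator≡ (λ ν≤x → ∈-upward ν≤x generator∈) fx≡zero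
    where
    open Kernel isPM
    open PrincipalIndicator generator
    open HA.IsFilter (kernel-isFilter isPM)

    fx≡zero : ¬ generator A.≤ x → f x ≡ zero
    fx≡zero ν≰x = [ id , (λ fx≡one → contradiction (generator-least fx≡one) ν≰x) ]′
                    (idempotent⇒zero⊎one (f-idempotent isPM x))

  ν-inverse : Inverse (P A hoop) (Idem A)
  ν-inverse = record
    { to        = ν
    ; from      = ν⁻¹
    ; to-cong   = λ {f} {g} → ν-cong {f} {g}
    ; from-cong = λ {d} {e} → ν⁻¹-cong {d} {e}
    ; inverse   = (λ {e} {f} f≈ν⁻¹e → trans (ν-cong {f} {ν⁻¹ e} f≈ν⁻¹e) (ν∘ν⁻¹ e))
                , (λ {f} {e} e≡νf x → trans (ν⁻¹-cong {e} {ν f} e≡νf x) (ν⁻¹∘ν f x))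
    }

module ProductMorphismsFromChain (M : FiniteMVChain) (A : Hoop) where
  open FiniteMVChain M using (hoop; zero)
  open FiniteMVChainProperties M using (_≟_; zero≢one; one⊎nilpotent)
  open ProductMorphismProperties using (f-idempotent; f-^2^)
  private
    module A = Hoop A
    module Mʰ = Hoop hoop
    module HM = HoopProperties hoop
    module PA = Setoid (P hoop A)
    module Id = Setoid (Idem A)

    module IndicatorOfOne (e : A.Carrier) = Indicator {hoop} {A} (_≟ Mʰ.one) e

  x≢one⇒fx≡fzero : ∀ {f} → IsProductMorphism hoop A f → ∀ {x} → x ≢ Mʰ.one → f x ≡ f zero
  x≢one⇒fx≡fzero {f} isPM {x} x≢one with one⊎nilpotent x
  ... | inj₁ x≡one          = contradiction x≡one x≢one
  ... | inj₂ (k , x^2^k≡zero) = trans (sym (f-^2^ isPM k x)) (cong f x^2^k≡zero)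

  μ : PA.Carrier → Id.Carrier
  μ (f , isPM) = f zero , f-idempotent isPM zero

  μ⁻¹ : Id.Carrier → PA.Carrier
  μ⁻¹ (e , e·e≡e) = indicator , indicator-isProductMorphism HM.≡one-isFilter e·e≡e
    where open IndicatorOfOne e

  μ⁻¹-cong : ∀ {d e} → d Id.≈ e → μ⁻¹ d PA.≈ μ⁻¹ e
  μ⁻¹-cong {_ , _} {_ , _} refl _ = refl

  μ∘μ⁻¹ : ∀ e → μ (μ⁻¹ e) Id.≈ e
  μ∘μ⁻¹ (e , _) = indicator-∉ zero≢one
    where open IndicatorOfOne e

  μ⁻¹∘μ : ∀ f → μ⁻¹ (μ f) PA.≈ f
  μ⁻¹∘μ (f , isPM) x = indicator≡ (λ x≡one → trans (cong f x≡one) pres-one) (x≢one⇒fx≡fzero isPM)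
    where
    open IndicatorOfOne (f zero)
    open IsProductMorphism isPM using (pres-one)

  μ-inverse : Inverse (P hoop A) (Idem A)
  μ-inverse = record
    { to        = μ
    ; from      = μ⁻¹
    ; to-cong   = λ f≈g → f≈g zero
    ; from-cong = λ {d} {e} → μ⁻¹-cong {d} {e}
    ; inverse   = (λ {e} f≈μ⁻¹e → trans (f≈μ⁻¹e zero) (μ∘μ⁻¹ e))
                , (λ {f} {e} e≡μf x → trans (μ⁻¹-cong {e} {μ f} e≡μf x) (μ⁻¹∘μ f x))
    }

theorem19 : (A : Hoop) → Finite (Hoop.Carrier A) → (M : FiniteMVChain)
    → Bijection (P A (FiniteMVChain.hoop M)) (Idem A)
    × Bijection (P (FiniteMVChain.hoop M) A) (Idem A)
theorem19 A finA M = Inverse⇒Bijection (ProductMorphismsToChain.ν-inverse A finA M)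
                   , Inverse⇒Bijection (ProductMorphismsFromChain.μ-inverse M A)
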